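{- Let $G$ be a graph and $k\ge2$. Suppose the cop is at a vertex $c_0$ and the robber is at a vertex $r_0$ that is $k$-proj-safe with respect to $c_0$, and suppose the cop moves from $c_0$ to $c_1$ (so $c_1$ is adjacent to $c_0$). (1) The robber has a move (to a vertex adjacent to $r_0$) to a vertex that is $(k-1)$-proj-safe with respect to $c_1$. (2) Furthermore, if there is $c_1'\in F_k(c_1)$ such that $r_0$ is not cornered by $c_1'$ in $G_k$, then the robber has a move to a vertex that is $k$-proj-safe with respect to $c_1$.
   Context: All graphs are finite, nonempty and reflexive (every vertex adjacent to itself); a move is staying put or moving to an adjacent vertex. For distinct vertices $v,w$ of a graph $H$: $w$ corners $v$ in $H$ if every vertex of $H$ adjacent to $v$ is adjacent to $w$; strictly corners if moreover some vertex of $H$ adjacent to $w$ is not adjacent to $v$; a strict corner of $H$ is a vertex strictly cornered in $H$ by another vertex. We also say $c$ corners $x$ in $H$ when $c=x$. Corner ranking: $G_1=G$, $k=1$. If $G_k$ is a clique, its vertices get rank $k$; stop. Else if $G_k$ has no strict corners, its vertices get rank $\infty$; stop. Else the set $X$ of strict corners of $G_k$ gets rank $k$, $G_{k+1}=G_k-X$, increase $k$, repeat. $\mathrm{cr}(v)$ is the rank of $v$. Projections: for $k$ with $G_{k+1}$ defined, $f_k(\{u\})=\{u\}$ if $\mathrm{cr}(u)>k$, otherwise the set of vertices of $G_{k+1}$ that strictly corner $u$ in $G_k$; $f_k(S)=\bigcup_{u\in S}f_k(\{u\})$; $F_1$ the identity, $F_k=f_{k-1}\circ\cdots\circ f_1$,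 $F_k(v)=F_k(\{v\})$. With the cop at $c$, a vertex $x$ is $k$-proj-safe if $\mathrm{cr}(x)\ge k$ and some $c'\in F_k(c)$ is not adjacent to $x$. -}

module Defs where

open import Data.Nat using (ℕ; zero; suc; _≤_; _∸_)
open import Data.Fin using (Fin; _≟_)
open import Data.Fin.Properties using (all?; any?)
open import Data.Fin.Subset using (Subset; _∈_; ⊤)
open import Data.Fin.Subset.Properties using (_∈?_)
open import Data.Vec using (tabulate)
open import Data.Product using (Σ; ∃; _×_; _,_)
open import Data.Sum using (_⊎_)
open import Data.Unit using () renaming (⊤ to Unit)
open import Data.Bool using (true; false)
open import Relation.Nullary using (¬_; Dec; does)
open import Relation.Nullary.Decidable using (_×-dec_; _⊎-dec_; _→-dec_; ¬?)
open import Relation.Binary.PropositionalEquality using (_≡_; _≢_)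

record Graph : Set₁ where
  field
    n        : ℕ
    nonempty : 1 ≤ n
    _∼_      : Fin n → Fin n → Set
    _∼?_     : (u v : Fin n) → Dec (u ∼ v)
    ∼-refl   : ∀ v → v ∼ v
    ∼-sym    : ∀ {u v} → u ∼ v → v ∼ u

data Rank : Set where
  fin : ℕ → Rank
  ∞   : Rank

_≥ʳ_ : Rank → ℕ → Set
fin a ≥ʳ k = k ≤ a
∞     ≥ʳ k = Unit

module _ (G : Graph) where
  open Graph G

  V : Set
  V = Fin n

  -- Induced subgraphs H of G are given by their vertex set S : Subset n.

  CornersIn : Subset n → V → V → Set
  CornersIn S w v = (w ≡ v) ⊎ (∀ u → u ∈ S → u ∼ v → u ∼ w)

  StrictlyCornersIn : Subset n → V → V → Set
  StrictlyCornersIn S w v =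
    (w ≢ v) × (∀ u → u ∈ S → u ∼ v → u ∼ w) × (∃ λ u → u ∈ S × u ∼ w × ¬ (u ∼ v))

  StrictCorner : Subset n → V → Set
  StrictCorner S v = v ∈ S × (∃ λ w → w ∈ S × StrictlyCornersIn S w v)

  IsClique : Subset n → Set
  IsClique S = ∀ u v → u ∈ S → v ∈ S → u ∼ v

  strictlyCornersIn? : ∀ S w v → Dec (StrictlyCornersIn S w v)
  strictlyCornersIn? S w v =
    ¬? (w ≟ v)
    ×-dec all? (λ u → (u ∈? S) →-dec ((u ∼? v) →-dec (u ∼? w)))
    ×-dec any? (λ u → (u ∈? S) ×-dec (u ∼? w) ×-dec ¬? (u ∼? v))

  strictCorner? : ∀ S v → Dec (StrictCorner S v)
  strictCorner? S v = (v ∈? S) ×-dec any? (λ w → (w ∈? S) ×-dec strictlyCornersIn? S w v)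

  isClique? : ∀ S → Dec (IsClique S)
  isClique? S = all? (λ u → all? (λ v → (u ∈? S) →-dec ((v ∈? S) →-dec (u ∼? v))))

  removeStrictCorners : Subset n → Subset n
  removeStrictCorners S = tabulate (λ v → does ((v ∈? S) ×-dec ¬? (strictCorner? S v)))

  -- Stage k (for k ≥ 1) is the vertex set of G_k.
  -- Convention: when the ranking stops (G_k a clique, or no strict corners),
  -- X = ∅, so the sequence is stationary from then on.
  Stage : ℕ → Subset n
  Stage zero          = ⊤
  Stage (suc zero)    = ⊤
  Stage (suc (suc k)) = removeStrictCorners (Stage (suc k))

  RankedAt : ℕ → V → Set
  RankedAt k v = v ∈ Stage k × (IsClique (Stage k) ⊎ StrictCorner (Stage k) v)

  rankedAt? : ∀ k v → Dec (RankedAt k v)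
  rankedAt? k v = (v ∈? Stage k) ×-dec (isClique? (Stage k) ⊎-dec strictCorner? (Stage k) v)

  searchRank : ℕ → ℕ → V → Rank
  searchRank zero     k v = ∞
  searchRank (suc f)  k v with does (rankedAt? k v)
  ... | true  = fin k
  ... | false = searchRank f (suc k) v

  -- Corner rank cr(v).  The ranking stops by stage n, so n stages suffice.
  cr : V → Rank
  cr v = searchRank n 1 v

  Inf : ℕ → V → V → Set
  Inf k u x =
      (cr u ≥ʳ suc k × x ≡ u)
    ⊎ (¬ (cr u ≥ʳ suc k) × x ∈ Stage (suc k) × StrictlyCornersIn (Stage k) x u)

  InF : ℕ → V → V → Set
  InF zero          c x = x ≡ c
  InF (suc zero)    c x = x ≡ c
  InF (suc (suc k)) c x = ∃ λ u → InF (suc k) c u × Inf (suc k) u x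

  ProjSafe : ℕ → V → V → Set
  ProjSafe k c x = cr x ≥ʳ k × (∃ λ c' → InF k c c' × ¬ (c' ∼ x))

module Submission where

-- Projections of adjacent cop positions are adjacent (each projection step moves a vertex to one
-- that dominates it in the current stage), and F_{k-1}(c₁) is nonempty because no stage below k is
-- a clique.  Pick d ∈ F_{k-1}(c₁).  If the robber had no neighbour in G_{k-1} outside N[d], then d
-- would dominate r₀ in G_{k-1}; since r₀ survives into G_k it is not a strict corner there, so r₀
-- dominates d in turn.  The safe projection c′ ∈ F_k(c₀) is adjacent to d, hence to r₀: a
-- contradiction.  For (2), a neighbour of r₀ in G_k witnessing that c₁′ does not corner r₀ is a
-- k-proj-safe move.

open import Defs
open import Data.Nat using (ℕ; zero; suc; _+_; _≤_; _<_; _≤′_; ≤′-refl; ≤′-step; _∸_; z≤n; s≤s; _≤?_)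
open import Data.Nat.Properties
  using (≤-refl; ≤-trans; ≤-reflexive; ≤-pred; <-irrefl; n≤1+n; m≤n⇒m≤1+n; m<n⇒m<1+n; m≤n⇒m<n∨m≡n;
         ≰⇒>; +-comm; +-identityʳ; +-suc; +-monoʳ-≤; ≤⇒≤′)
open import Data.Nat.Induction using (<-wellFounded)
open import Induction.WellFounded using (Acc; acc)
open import Data.Fin using (Fin; _≟_)
open import Data.Fin.Properties using (any?)
open import Data.Fin.Subset using (Subset; _∈_; _⊆_; _⊂_; ∣_∣; inside; outside; ⁅_⁆)
open import Data.Fin.Subset.Properties
  using (_∈?_; ∈⊤; ⊆-antisym; drop-∷-⊂; drop-∷-⊆; p⊆q⇒∣p∣≤∣q∣; x∈⁅y⁆⇒x≡y; ∣⁅x⁆∣≡1; ∣⊤∣≡n)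
open import Data.Vec using (_∷_; []; tabulate; here)
open import Data.Vec.Properties using (lookup∘tabulate; []=⇒lookup; lookup⇒[]=)
open import Data.Product using (∃; _×_; _,_; proj₁; proj₂)
open import Data.Sum using (_⊎_; inj₁; inj₂)
open import Data.Unit using (tt)
open import Data.Bool using (true; false)
open import Data.Empty using (⊥-elim)
open import Function using (_∘_; id)
open import Relation.Nullary using (¬_; Dec; yes; no; does)
open import Relation.Nullary.Decidable using (_×-dec_; ¬?; dec-true; decidable-stable)
open import Relation.Binary.PropositionalEquality using (_≡_; _≢_; refl; sym; trans; subst)

p⊂q⇒∣p∣<∣q∣ : ∀ {m} {p q : Subset m} → p ⊂ q → ∣ p ∣ < ∣ q ∣
p⊂q⇒∣p∣<∣q∣ {p = []}          {[]}          (_ , () , _)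
p⊂q⇒∣p∣<∣q∣ {p = outside ∷ p} {outside ∷ q} p⊂q = p⊂q⇒∣p∣<∣q∣ (drop-∷-⊂ p⊂q)
p⊂q⇒∣p∣<∣q∣ {p = outside ∷ p} {inside ∷ q}  p⊂q = s≤s (p⊆q⇒∣p∣≤∣q∣ (drop-∷-⊆ (proj₁ p⊂q)))
p⊂q⇒∣p∣<∣q∣ {p = inside ∷ p}  {outside ∷ q} p⊂q with proj₁ p⊂q here
... | ()
p⊂q⇒∣p∣<∣q∣ {p = inside ∷ p}  {inside ∷ q}  p⊂q = s≤s (p⊂q⇒∣p∣<∣q∣ (drop-∷-⊂ p⊂q))

distinct-members⇒2≤∣p∣ : ∀ {m} {p : Subset m} {x y} → x ∈ p → y ∈ p → y ≢ x → 2 ≤ ∣ p ∣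
distinct-members⇒2≤∣p∣ {p = p} {x} {y} x∈p y∈p y≢x =
  subst (λ t → suc t ≤ ∣ p ∣) (∣⁅x⁆∣≡1 x) (p⊂q⇒∣p∣<∣q∣ (⁅x⁆⊆p , y , y∈p , y≢x ∘ x∈⁅y⁆⇒x≡y x))
  where
  ⁅x⁆⊆p : ⁅ x ⁆ ⊆ p
  ⁅x⁆⊆p z∈⁅x⁆ = subst (_∈ p) (sym (x∈⁅y⁆⇒x≡y x z∈⁅x⁆)) x∈p

does≡true⇒ : ∀ {A : Set} (a? : Dec A) → does a? ≡ true → A
does≡true⇒ (yes a) _ = a

module _ {m} {P : Fin m → Set} (P? : ∀ x → Dec (P x)) where

  ∈-tabulate-does⁻ : ∀ {x} → x ∈ tabulate (does ∘ P?) → P x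
  ∈-tabulate-does⁻ {x} x∈ = does≡true⇒ (P? x) (trans (sym (lookup∘tabulate (does ∘ P?) x)) ([]=⇒lookup x∈))

  ∈-tabulate-does⁺ : ∀ {x} → P x → x ∈ tabulate (does ∘ P?)
  ∈-tabulate-does⁺ {x} px = lookup⇒[]= x _ (trans (lookup∘tabulate (does ∘ P?) x) (dec-true (P? x) px))

_≥ʳ?_ : ∀ r k → Dec (r ≥ʳ k)
fin a ≥ʳ? k = k ≤? a
∞     ≥ʳ? k = yes tt

≥ʳ-pred : ∀ {r m} → r ≥ʳ suc m → r ≥ʳ m
≥ʳ-pred {fin a} {m} r≥ = ≤-trans (n≤1+n m) r≥
≥ʳ-pred {∞}         _  = tt

module _ (G : Graph) where
  open Graph G

  Dominates : Subset n → V G → V G → Set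
  Dominates S w v = ∀ u → u ∈ S → u ∼ v → u ∼ w

  dominates-or-escape : ∀ S w v → Dominates S w v ⊎ ∃ λ u → u ∈ S × u ∼ v × ¬ u ∼ w
  dominates-or-escape S w v with any? (λ u → (u ∈? S) ×-dec (u ∼? v) ×-dec ¬? (u ∼? w))
  ... | yes escape = inj₂ escape
  ... | no ¬escape =
        inj₁ λ u u∈S u∼v → decidable-stable (u ∼? w) (λ u≁w → ¬escape (u , u∈S , u∼v , u≁w))

  strictlyCorners-trans : ∀ {S u w w′} →
    StrictlyCornersIn G S w u → StrictlyCornersIn G S w′ w → StrictlyCornersIn G S w′ u
  strictlyCorners-trans {u = u} {w′ = w′}
    (_ , w-dom-u , z , z∈S , z∼w , z≁u) (_ , w′-dom-w , t , t∈S , t∼w′ , t≁w) =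
    w′≢u , (λ y y∈S → w′-dom-w y y∈S ∘ w-dom-u y y∈S) , z , z∈S , w′-dom-w z z∈S z∼w , z≁u
    where
    w′≢u : w′ ≢ u
    w′≢u refl = t≁w (w-dom-u t t∈S t∼w′)

  ∈-removeStrictCorners⁻ : ∀ {S x} → x ∈ removeStrictCorners G S → x ∈ S × ¬ StrictCorner G S x
  ∈-removeStrictCorners⁻ {S} = ∈-tabulate-does⁻ (λ v → (v ∈? S) ×-dec ¬? (strictCorner? G S v))

  ∈-removeStrictCorners⁺ : ∀ {S x} → x ∈ S → ¬ StrictCorner G S x → x ∈ removeStrictCorners G S
  ∈-removeStrictCorners⁺ {S} x∈S ¬sc =
    ∈-tabulate-does⁺ (λ v → (v ∈? S) ×-dec ¬? (strictCorner? G S v)) (x∈S , ¬sc)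

  removeStrictCorners-⊂ : ∀ {S x} → StrictCorner G S x → removeStrictCorners G S ⊂ S
  removeStrictCorners-⊂ sc@(x∈S , _) =
    proj₁ ∘ ∈-removeStrictCorners⁻ , _ , x∈S , λ x∈ → proj₂ (∈-removeStrictCorners⁻ x∈) sc

  removeStrictCorners-id : ∀ {S} → (∀ v → ¬ StrictCorner G S v) → removeStrictCorners G S ≡ S
  removeStrictCorners-id none =
    ⊆-antisym (proj₁ ∘ ∈-removeStrictCorners⁻) (λ x∈S → ∈-removeStrictCorners⁺ x∈S (none _))

  -- A vertex that survives the removal is not strictly cornered, so whoever dominates it is its twin.
  ∈-removeStrictCorners⇒dominates-dominator : ∀ {S v w} →
    v ∈ removeStrictCorners G S → w ∈ S → Dominates S w v → Dominates S v w
  ∈-removeStrictCorners⇒dominates-dominator {v = v} {w} v∈ w∈S w-dom-v with w ≟ v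
  ... | yes refl = λ _ _ → id
  ... | no w≢v   = λ u u∈S u∼w → decidable-stable (u ∼? v) λ u≁v →
        proj₂ (∈-removeStrictCorners⁻ v∈)
          (proj₁ (∈-removeStrictCorners⁻ v∈) , w , w∈S , w≢v , w-dom-v , u , u∈S , u∼w , u≁v)

  Stage-suc-⊆ : ∀ m → Stage G (suc m) ⊆ Stage G m
  Stage-suc-⊆ zero    _  = ∈⊤
  Stage-suc-⊆ (suc m) x∈ = proj₁ (∈-removeStrictCorners⁻ x∈)

  Stage-anti′ : ∀ {a b} → a ≤′ b → Stage G b ⊆ Stage G a
  Stage-anti′ ≤′-refl      = id
  Stage-anti′ (≤′-step {b} a≤b) = Stage-anti′ a≤b ∘ Stage-suc-⊆ b

  Stage-anti : ∀ {a b} → a ≤ b → Stage G b ⊆ Stage G a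
  Stage-anti = Stage-anti′ ∘ ≤⇒≤′

  -- Each stage that still has a strict corner is strictly smaller than the previous one.
  strictCorner⇒stage-size : ∀ i {x} → StrictCorner G (Stage G (suc i)) x → i + ∣ Stage G (suc i) ∣ ≤ n
  strictCorner⇒stage-size zero    _ = ≤-reflexive (∣⊤∣≡n n)
  strictCorner⇒stage-size (suc i) {x} sc with any? (strictCorner? G (Stage G (suc i)))
  ... | yes (_ , sc′) =
        ≤-trans (≤-reflexive (sym (+-suc i _)))
          (≤-trans (+-monoʳ-≤ i (p⊂q⇒∣p∣<∣q∣ (removeStrictCorners-⊂ sc′)))
            (strictCorner⇒stage-size i sc′))
  ... | no none =
        ⊥-elim (none (x , subst (λ S → StrictCorner G S x) (removeStrictCorners-id (λ v → none ∘ (v ,_))) sc))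

  strictCorner⇒stage<n : ∀ i {x} → StrictCorner G (Stage G (suc i)) x → suc i < n
  strictCorner⇒stage<n i sc@(x∈S , w , w∈S , w≢x , _) =
    ≤-trans (≤-reflexive (+-comm 2 i))
      (≤-trans (+-monoʳ-≤ i (distinct-members⇒2≤∣p∣ x∈S w∈S w≢x)) (strictCorner⇒stage-size i sc))

  NoCliqueUpTo : ℕ → Set
  NoCliqueUpTo m = ∀ i → i ≤ m → ¬ IsClique G (Stage G i)

  noCliqueUpTo-pred : ∀ {m} → NoCliqueUpTo (suc m) → NoCliqueUpTo m
  noCliqueUpTo-pred noClique i i≤m = noClique i (m≤n⇒m≤1+n i≤m)

  searchRank-sound : ∀ f s {x i} → searchRank G f s x ≡ fin i → RankedAt G i x × s ≤ i
  searchRank-sound zero    s ()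
  searchRank-sound (suc f) s {x} found with does (rankedAt? G s x) in ranked?
  searchRank-sound (suc f) s {x} refl | true = does≡true⇒ (rankedAt? G s x) ranked? , ≤-refl
  ... | false = let ranked , s<i = searchRank-sound f (suc s) found in ranked , ≤-trans (n≤1+n s) s<i

  searchRank-complete : ∀ f s {x i} → RankedAt G i x → s ≤ i → i < s + f →
                        ∃ λ i′ → searchRank G f s x ≡ fin i′ × i′ ≤ i
  searchRank-complete zero    s _ s≤i i<s+0 =
    ⊥-elim (<-irrefl refl (≤-trans i<s+0 (≤-trans (≤-reflexive (+-identityʳ s)) s≤i)))
  searchRank-complete (suc f) s {x} ranked s≤i i<s+f with does (rankedAt? G s x) in ranked?
  ... | true  = s , refl , s≤i
  ... | false with m≤n⇒m<n∨m≡n s≤i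
  ...   | inj₂ refl with () ← trans (sym (dec-true (rankedAt? G s x) ranked)) ranked?
  ...   | inj₁ s<i  = searchRank-complete f (suc s) ranked s<i (≤-trans i<s+f (≤-reflexive (+-suc s f)))

  -- The ranking stops by stage n, so cr never runs out of fuel before ranking a vertex.
  cr≥⇒∈Stage : ∀ m {x} → cr G x ≥ʳ suc m → x ∈ Stage G (suc m)
  cr≥⇒∈Stage zero    _ = ∈⊤
  cr≥⇒∈Stage (suc m) {x} cr≥ with strictCorner? G (Stage G (suc m)) x
  ... | no ¬sc = ∈-removeStrictCorners⁺ (cr≥⇒∈Stage m (≥ʳ-pred {cr G x} cr≥)) ¬sc
  ... | yes sc@(x∈S , _)
    with searchRank-complete n 1 (x∈S , inj₂ sc) (s≤s z≤n) (m<n⇒m<1+n (strictCorner⇒stage<n m sc))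
  ...   | i , cr≡i , i≤ = ⊥-elim (<-irrefl refl (≤-trans (subst (_≥ʳ suc (suc m)) cr≡i cr≥) i≤))

  ∈Stage⇒cr≥ : ∀ m {x} → NoCliqueUpTo m → x ∈ Stage G (suc m) → cr G x ≥ʳ suc m
  ∈Stage⇒cr≥ m {x} noClique x∈ with cr G x in cr≡
  ... | ∞ = tt
  ... | fin i with suc m ≤? i
  ...   | yes m<i = m<i
  ...   | no m≮i with searchRank-sound n 1 cr≡
  ...     | (_ , inj₁ clique) , _ = ⊥-elim (noClique i (≤-pred (≰⇒> m≮i)) clique)
  ...     | (_ , inj₂ sc) , s≤s _ = ⊥-elim (proj₂ (∈-removeStrictCorners⁻ (Stage-anti (≰⇒> m≮i) x∈)) sc)

  InF⇒∈Stage : ∀ m {c x} → InF G (suc m) c x → x ∈ Stage G (suc m)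
  InF⇒∈Stage zero    _                             = ∈⊤
  InF⇒∈Stage (suc m) (_ , _ , inj₁ (cr≥ , refl)) = cr≥⇒∈Stage (suc m) cr≥
  InF⇒∈Stage (suc m) (_ , _ , inj₂ (_ , x∈ , _)) = x∈

  Inf-preserves-∼ : ∀ m {u x y} → Inf G m u x → y ∈ Stage G m → y ∼ u → y ∼ x
  Inf-preserves-∼ m (inj₁ (_ , refl))                _   y∼u = y∼u
  Inf-preserves-∼ m (inj₂ (_ , _ , _ , x-dom-u , _)) y∈S y∼u = x-dom-u _ y∈S y∼u

  InF-adjacent : ∀ m {c c′ a b} → c ∼ c′ → InF G (suc m) c a → InF G (suc m) c′ b → a ∼ b
  InF-adjacent zero    c∼c′ refl refl = c∼c′
  InF-adjacent (suc m) c∼c′ a∈F@(u , u∈F , u↦a) (v , v∈F , v↦b) =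
    Inf-preserves-∼ (suc m) v↦b (Stage-suc-⊆ (suc m) (InF⇒∈Stage (suc m) a∈F))
      (∼-sym (Inf-preserves-∼ (suc m) u↦a (InF⇒∈Stage m v∈F) (∼-sym (InF-adjacent m c∼c′ u∈F v∈F))))

  nonNeighbours : Subset n → V G → Subset n
  nonNeighbours S w = tabulate (does ∘ λ y → (y ∈? S) ×-dec ¬? (y ∼? w))

  strictlyCorners⇒nonNeighbours-⊂ : ∀ {S w w′} →
    StrictlyCornersIn G S w′ w → nonNeighbours S w′ ⊂ nonNeighbours S w
  strictlyCorners⇒nonNeighbours-⊂ {S} {w} {w′} (_ , w′-dom-w , z , z∈S , z∼w′ , z≁w) =
    (λ y∈ → let y∈S , y≁w′ = out w′ y∈ in into w y∈S (y≁w′ ∘ w′-dom-w _ y∈S)) ,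
    z , into w z∈S z≁w , λ z∈ → proj₂ (out w′ z∈) z∼w′
    where
    into : ∀ v {y} → y ∈ S → ¬ y ∼ v → y ∈ nonNeighbours S v
    into v y∈S y≁v = ∈-tabulate-does⁺ (λ y → (y ∈? S) ×-dec ¬? (y ∼? v)) (y∈S , y≁v)
    out : ∀ v {y} → y ∈ nonNeighbours S v → y ∈ S × ¬ y ∼ v
    out v = ∈-tabulate-does⁻ (λ y → (y ∈? S) ×-dec ¬? (y ∼? v))

  strictlyCornered⇒cornered-by-nonStrictCorner : ∀ {S u w} → w ∈ S → StrictlyCornersIn G S w u →
    ∃ λ w* → w* ∈ S × StrictlyCornersIn G S w* u × ¬ StrictCorner G S w*
  strictlyCornered⇒cornered-by-nonStrictCorner {S} {u} w∈S w↑u = go w∈S w↑u (<-wellFounded _)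
    where
    go : ∀ {w} → w ∈ S → StrictlyCornersIn G S w u → Acc _<_ ∣ nonNeighbours S w ∣ →
         ∃ λ w* → w* ∈ S × StrictlyCornersIn G S w* u × ¬ StrictCorner G S w*
    go {w} w∈S w↑u (acc rs) with strictCorner? G S w
    ... | no ¬sc = w , w∈S , w↑u , ¬sc
    ... | yes (_ , w′ , w′∈S , w′↑w) =
          go w′∈S (strictlyCorners-trans w↑u w′↑w) (rs (p⊂q⇒∣p∣<∣q∣ (strictlyCorners⇒nonNeighbours-⊂ w′↑w)))

  InF-nonempty : ∀ m c → NoCliqueUpTo m → ∃ λ d → InF G (suc m) c d
  InF-nonempty zero    c _ = c , refl
  InF-nonempty (suc m) c noClique with InF-nonempty m c (noCliqueUpTo-pred noClique)
  ... | u , u∈F with cr G u ≥ʳ? suc (suc m)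
  ...   | yes cr≥ = u , u , u∈F , inj₁ (cr≥ , refl)
  ...   | no cr≱ with strictCorner? G (Stage G (suc m)) u
  ...     | yes (_ , w , w∈S , w↑u) =
              let w* , w*∈S , w*↑u , ¬sc = strictlyCornered⇒cornered-by-nonStrictCorner w∈S w↑u
              in  w* , u , u∈F , inj₂ (cr≱ , ∈-removeStrictCorners⁺ w*∈S ¬sc , w*↑u)
  ...     | no ¬sc = ⊥-elim (cr≱ (∈Stage⇒cr≥ (suc m) noClique (∈-removeStrictCorners⁺ (InF⇒∈Stage m u∈F) ¬sc)))

  projSafe⇒noCliqueUpTo : ∀ m {c x} → ProjSafe G (suc m) c x → NoCliqueUpTo (suc m)
  projSafe⇒noCliqueUpTo m (cr≥ , c′ , c′∈F , c′≁x) i i≤ clique =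
    c′≁x (clique c′ _ (Stage-anti i≤ (InF⇒∈Stage m c′∈F)) (Stage-anti i≤ (cr≥⇒∈Stage m cr≥)))

  escape⇒projSafe : ∀ m {c d y} → NoCliqueUpTo m → InF G (suc m) c d → y ∈ Stage G (suc m) → ¬ y ∼ d →
                    ProjSafe G (suc m) c y
  escape⇒projSafe m noClique d∈F y∈S y≁d = ∈Stage⇒cr≥ m noClique y∈S , _ , d∈F , y≁d ∘ ∼-sym

  dominating-projection⇒adjacent : ∀ j {c₀ c₁ r₀ c′ d} → r₀ ∈ Stage G (suc (suc j)) → c₀ ∼ c₁ →
    InF G (suc (suc j)) c₀ c′ → InF G (suc j) c₁ d → Dominates (Stage G (suc j)) d r₀ → c′ ∼ r₀
  dominating-projection⇒adjacent j {r₀ = r₀} {c′} {d} r₀∈ c₀∼c₁ c′∈F@(u₀ , u₀∈F , u₀↦c′) d∈F d-dom-r₀ =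
    r₀-dom-d c′ (Stage-suc-⊆ (suc j) (InF⇒∈Stage (suc j) c′∈F)) (∼-sym d∼c′)
    where
    d∈S : d ∈ Stage G (suc j)
    d∈S = InF⇒∈Stage j d∈F
    r₀-dom-d : Dominates (Stage G (suc j)) r₀ d
    r₀-dom-d = ∈-removeStrictCorners⇒dominates-dominator r₀∈ d∈S d-dom-r₀
    d∼c′ : d ∼ c′
    d∼c′ = Inf-preserves-∼ (suc j) u₀↦c′ d∈S (∼-sym (InF-adjacent j c₀∼c₁ u₀∈F d∈F))

  projSafe-after-cop-move : ∀ j {c₀ c₁ r₀} → ProjSafe G (suc (suc j)) c₀ r₀ → c₀ ∼ c₁ →
                            ∃ λ r₁ → r₀ ∼ r₁ × ProjSafe G (suc j) c₁ r₁
  projSafe-after-cop-move j {c₁ = c₁} {r₀} safe@(cr≥ , c′ , c′∈F , c′≁r₀) c₀∼c₁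
    with noCliqueUpTo-pred (noCliqueUpTo-pred (projSafe⇒noCliqueUpTo (suc j) safe))
  ... | noClique with InF-nonempty j c₁ noClique
  ...   | d , d∈F with dominates-or-escape (Stage G (suc j)) d r₀
  ...     | inj₂ (y , y∈S , y∼r₀ , y≁d) = y , ∼-sym y∼r₀ , escape⇒projSafe j noClique d∈F y∈S y≁d
  ...     | inj₁ d-dom-r₀ =
              ⊥-elim (c′≁r₀ (dominating-projection⇒adjacent j (cr≥⇒∈Stage (suc j) cr≥) c₀∼c₁ c′∈F d∈F d-dom-r₀))

  projSafe-if-projection-misses-corner : ∀ m {c₀ c₁ r₀} → ProjSafe G (suc m) c₀ r₀ →
    (∃ λ c₁′ → InF G (suc m) c₁ c₁′ × ¬ CornersIn G (Stage G (suc m)) c₁′ r₀) →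
    ∃ λ r₁ → r₀ ∼ r₁ × ProjSafe G (suc m) c₁ r₁
  projSafe-if-projection-misses-corner m {r₀ = r₀} safe (c₁′ , c₁′∈F , ¬corners)
    with dominates-or-escape (Stage G (suc m)) c₁′ r₀
  ... | inj₁ c₁′-dom-r₀              = ⊥-elim (¬corners (inj₂ c₁′-dom-r₀))
  ... | inj₂ (y , y∈S , y∼r₀ , y≁c₁′) =
        y , ∼-sym y∼r₀ , escape⇒projSafe m (noCliqueUpTo-pred (projSafe⇒noCliqueUpTo m safe)) c₁′∈F y∈S y≁c₁′

lemma5p4 : (G : Graph) → (k : ℕ) → 2 ≤ k →
    (c₀ c₁ r₀ : Fin (Graph.n G)) →
    ProjSafe G k c₀ r₀ →
    Graph._∼_ G c₀ c₁ →
    (∃ λ r₁ → Graph._∼_ G r₀ r₁ × ProjSafe G (k ∸ 1) c₁ r₁)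
    × ((∃ λ c₁' → InF G k c₁ c₁' × ¬ CornersIn G (Stage G k) c₁' r₀) →
       ∃ λ r₁ → Graph._∼_ G r₀ r₁ × ProjSafe G k c₁ r₁)
lemma5p4 G (suc (suc j)) _ c₀ c₁ r₀ safe c₀∼c₁ =
  projSafe-after-cop-move G j safe c₀∼c₁ , projSafe-if-projection-misses-corner G (suc j) safe
lemma5p4 G 1 (s≤s ())
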